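{- For every infinite $a\subseteq\omega$, $\mathcal{F}_{\mathcal{P}(a)}=\{b\subseteq\omega : a\subseteq^* b\}$, where $a\subseteq^*b$ means $a\setminus b$ is finite.
   Context: Subsets of $\omega$ are identified with elements of $2^\omega$ via characteristic functions, so $\mathcal{P}(a)\subseteq2^\omega$. For distinct $x,y\in2^\omega$ let $h(x,y)=\min\{n:x(n)\ne y(n)\}$; for $X\subseteq2^\omega$, $H(X)=\{h(x,y):x,y\in X,x\ne y\}$. The Raisonnier filter $\mathcal{F}_X$ is the set of all $a\subseteq\omega$ for which there is a countable family $\{Y_n:n<\omega\}$ of subsets of $2^\omega$ with $X\subseteq\bigcup_nY_n$ and $a\supseteq\bigcup_nH(Y_n)$. -}

module Defs where

open import Data.Bool using (Bool; true; false)
open import Data.Nat using (ℕ; _<_; _≤_)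
open import Data.Product using (Σ; ∃; _×_)
open import Relation.Binary.PropositionalEquality using (_≡_; _≢_)
open import Relation.Nullary using (¬_)

-- Subsets of ω, identified with elements of 2^ω via characteristic functions.
Cantor : Set
Cantor = ℕ → Bool

SubCantor : Set₁
SubCantor = Cantor → Set

_∈ω_ : ℕ → Cantor → Set
n ∈ω a = a n ≡ true

IsH : Cantor → Cantor → ℕ → Set
IsH x y n = (∀ m → m < n → x m ≡ y m) × x n ≢ y n

H : SubCantor → ℕ → Set
H Y n = Σ Cantor λ x → Σ Cantor λ y → Y x × Y y × ¬ (x ≡ y) × IsH x y n

𝒫 : Cantor → SubCantor
𝒫 a x = ∀ n → n ∈ω x → n ∈ω a

RaisonnierFilter : SubCantor → Cantor → Set₁
RaisonnierFilter X a =
  Σ (ℕ → SubCantor) λ Y →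
    (∀ x → X x → ∃ λ n → Y n x) ×
    (∀ n k → H (Y n) k → k ∈ω a)

FiniteSet : (ℕ → Set) → Set
FiniteSet S = ∃ λ N → ∀ n → S n → n < N

Infinite : Cantor → Set
Infinite a = ∀ N → ∃ λ n → N ≤ n × n ∈ω a

_⊆*_ : Cantor → Cantor → Set
a ⊆* b = FiniteSet (λ n → n ∈ω a × ¬ (n ∈ω b))

-- If a ⊆* b, say a ∖ b ⊆ N, split 𝒫(a) into the countably many classes of sets with
-- the same trace on N; two members of one class first differ at a point of a outside N,
-- hence of b. Conversely, if a ∖ b is infinite, enumerate it as k₀ < k₁ < ⋯ and
-- diagonalise: let x ⊆ a ∖ b contain kₙ exactly when Yₙ has a member y ⊆ a ∖ b omitting
-- kₙ. Then x ∈ Yₙ for some n; kₙ ∉ x would make x such a y, and kₙ ∈ x yields such a y,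
-- so h(x, y) ∈ H(Yₙ) ⊆ b, while h(x, y) ∈ x ∪ y ⊆ a ∖ b.
module Submission where

open import Defs
open import Level using (0ℓ; lift; lower)
open import Axiom.ExcludedMiddle using (ExcludedMiddle)
open import Data.Bool using (Bool; true; false)
import Data.Bool as Bool
open import Data.Nat using (ℕ; zero; suc; _<_; _≤_; s≤s)
open import Data.Nat.Properties using (≰⇒>; ≮⇒≥; <⇒≱; <⇒≢; >⇒≢; <-trans; <-cmp; m≤n⇒m<n∨m≡n)
open import Data.Nat.Binary using (ℕᵇ; zero; 2[1+_]; 1+[2_]; toℕ; fromℕ)
open import Data.Nat.Binary.Properties using (fromℕ-toℕ)
open import Data.Product using (_×_; _,_; ∃; proj₁; proj₂; uncurry)
open import Data.Sum using (_⊎_; inj₁; inj₂; [_,_]′)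
open import Function using (_∘_)
open import Function.Definitions using (Injective)
open import Relation.Binary using (tri<; tri≈; tri>)
open import Relation.Binary.PropositionalEquality using (_≡_; _≢_; refl; sym; trans; cong; subst)
open import Relation.Nullary using (¬_; yes; no; does; contradiction)
open import Relation.Nullary.Decidable using (dec-true; dec-false; decidable-stable; map′)

_⊆_ : Cantor → (ℕ → Set) → Set
x ⊆ C = ∀ n → n ∈ω x → C n

≢⇒one-true : {u v : Bool} → u ≢ v → u ≡ true ⊎ v ≡ true
≢⇒one-true {true}          _   = inj₁ refl
≢⇒one-true {false} {true}  _   = inj₂ refl
≢⇒one-true {false} {false} u≢v = contradiction refl u≢v

true-false⇒≢ : {u v : Bool} → u ≡ true → v ≡ false → u ≢ v
true-false⇒≢ refl refl ()

IsH-⊆ : ∀ {C : ℕ → Set} {x y k} → IsH x y k → x ⊆ C → y ⊆ C → C k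
IsH-⊆ {k = k} (_ , xk≢yk) x⊆C y⊆C = [ x⊆C k , y⊆C k ]′ (≢⇒one-true xk≢yk)

least-difference : ∀ {x y : Cantor} k → x k ≢ y k → ∃ (IsH x y)
least-difference zero xk≢yk = zero , (λ _ ()) , xk≢yk
least-difference {x} {y} (suc k) xk≢yk with x 0 Bool.≟ y 0
... | no x0≢y0 = zero , (λ _ ()) , x0≢y0
... | yes x0≡y0 with least-difference {x ∘ suc} {y ∘ suc} k xk≢yk
...   | j , agree , differ = suc j , agree′ , differ
  where
  agree′ : ∀ m → m < suc j → x m ≡ y m
  agree′ zero    _         = x0≡y0
  agree′ (suc m) (s≤s m<j) = agree m m<j

H-meets : ∀ {Y : SubCantor} {C : ℕ → Set} {x y k} → Y x → Y y → x ⊆ C → y ⊆ C →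
          x k ≡ true → y k ≡ false → ∃ λ j → H Y j × C j
H-meets {x = x} {y} {k} Yx Yy x⊆C y⊆C xk≡true yk≡false
  with least-difference k (true-false⇒≢ xk≡true yk≡false)
... | j , isH = j , (x , y , Yx , Yy , x≢y , isH) , IsH-⊆ isH x⊆C y⊆C
  where
  x≢y : x ≢ y
  x≢y = true-false⇒≢ xk≡true yk≡false ∘ cong (λ z → z k)

digit : Bool → ℕᵇ → ℕᵇ
digit true  = 2[1+_]
digit false = 1+[2_]

prefix : ℕ → Cantor → ℕᵇ
prefix zero    x = zero
prefix (suc N) x = digit (x 0) (prefix N (x ∘ suc))

digit-injective : ∀ {u v m n} → digit u m ≡ digit v n → u ≡ v × m ≡ n
digit-injective {true}  {true}  refl = refl , refl
digit-injective {false} {false} refl = refl , refl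
digit-injective {true}  {false} ()
digit-injective {false} {true}  ()

prefix-injective : ∀ N {x y} → prefix N x ≡ prefix N y → ∀ j → j < N → x j ≡ y j
prefix-injective (suc N) eq zero    _         = proj₁ (digit-injective eq)
prefix-injective (suc N) eq (suc j) (s≤s j<N) =
  prefix-injective N (proj₂ (digit-injective eq)) j j<N

⊆*⇒filter : (a b : Cantor) → a ⊆* b → RaisonnierFilter (𝒫 a) b
⊆*⇒filter a b (N , a∖b<N) = Y , cover , H⊆b
  where
  Y : ℕ → SubCantor
  Y m x = 𝒫 a x × prefix N x ≡ fromℕ m

  cover : ∀ x → 𝒫 a x → ∃ λ m → Y m x
  cover x x⊆a = toℕ (prefix N x) , x⊆a , sym (fromℕ-toℕ _)

  H⊆b : ∀ m k → H (Y m) k → k ∈ω b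
  H⊆b m k (x , y , (x⊆a , px) , (y⊆a , py) , _ , isH) =
    decidable-stable (b k Bool.≟ true) λ k∉b → <⇒≱ (a∖b<N k (k∈a , k∉b)) N≤k
    where
    k∈a : k ∈ω a
    k∈a = IsH-⊆ isH x⊆a y⊆a
    N≤k : N ≤ k
    N≤k = ≮⇒≥ λ k<N → proj₂ isH (prefix-injective N (trans px (sym py)) k k<N)

increasing⇒strictlyMonotone : {f : ℕ → ℕ} → (∀ n → f n < f (suc n)) →
                              ∀ {m n} → m < n → f m < f n
increasing⇒strictlyMonotone inc {m} {suc n} (s≤s m≤n) with m≤n⇒m<n∨m≡n m≤n
... | inj₁ m<n  = <-trans (increasing⇒strictlyMonotone inc m<n) (inc n)
... | inj₂ refl = inc n

increasing⇒injective : {f : ℕ → ℕ} → (∀ n → f n < f (suc n)) → Injective _≡_ _≡_ f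
increasing⇒injective inc {m} {n} fm≡fn with <-cmp m n
... | tri< m<n _ _ = contradiction fm≡fn (<⇒≢ (increasing⇒strictlyMonotone inc m<n))
... | tri≈ _ m≡n _ = m≡n
... | tri> _ _ n<m = contradiction fm≡fn (>⇒≢ (increasing⇒strictlyMonotone inc n<m))

module Enumeration {S : ℕ → Set} (unbounded : ∀ N → ∃ λ k → N ≤ k × S k) where

  enumerate : ℕ → ℕ
  enumerate zero    = proj₁ (unbounded 0)
  enumerate (suc n) = proj₁ (unbounded (suc (enumerate n)))

  enumerate-∈ : ∀ n → S (enumerate n)
  enumerate-∈ zero    = proj₂ (proj₂ (unbounded 0))
  enumerate-∈ (suc n) = proj₂ (proj₂ (unbounded (suc (enumerate n))))

  enumerate-injective : Injective _≡_ _≡_ enumerate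
  enumerate-injective = increasing⇒injective λ n → proj₁ (proj₂ (unbounded (suc (enumerate n))))

¬finite⇒unbounded : ExcludedMiddle 0ℓ → {S : ℕ → Set} → ¬ FiniteSet S →
                    ∀ N → ∃ λ k → N ≤ k × S k
¬finite⇒unbounded em ¬finite N = decidable-stable em λ ¬unbounded →
  ¬finite (N , λ n Sn → ≰⇒> λ N≤n → ¬unbounded (n , N≤n , Sn))

module Diagonal (em : ExcludedMiddle 0ℓ) {C : ℕ → Set} {k : ℕ → ℕ}
                (k-injective : Injective _≡_ _≡_ k) (k∈C : ∀ n → C (k n))
                (Y : ℕ → SubCantor) where

  Omits : ℕ → Cantor → Set
  Omits n y = Y n y × y ⊆ C × y (k n) ≡ false

  Marked : ℕ → Set
  Marked m = ∃ λ n → k n ≡ m × ∃ (Omits n)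

  diagonal : Cantor
  diagonal m = does (em {Marked m})

  diagonal-⊆ : diagonal ⊆ C
  diagonal-⊆ m _ with em {Marked m}
  diagonal-⊆ m _  | yes (n , kn≡m , _) = subst C kn≡m (k∈C n)
  diagonal-⊆ m () | no _

  diagonal-∉ : (∀ n j → H (Y n) j → ¬ C j) → ∀ n → ¬ Y n diagonal
  diagonal-∉ disjoint n Yn∆ with em {Marked (k n)}
  ... | yes marked@(n′ , kn′≡kn , y , Yn′y , y⊆C , yk≡false) with refl ← k-injective kn′≡kn =
    let j , Hj , Cj = H-meets Yn∆ Yn′y diagonal-⊆ y⊆C (dec-true em marked) yk≡false
    in disjoint n j Hj Cj
  ... | no ¬marked = ¬marked (n , refl , diagonal , Yn∆ , diagonal-⊆ , dec-false em ¬marked)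

unbounded-cover-meets-H : ExcludedMiddle 0ℓ → {C : ℕ → Set} → (∀ N → ∃ λ k → N ≤ k × C k) →
                          (Y : ℕ → SubCantor) → (∀ x → x ⊆ C → ∃ λ n → Y n x) →
                          ¬ (∀ n j → H (Y n) j → ¬ C j)
unbounded-cover-meets-H em {C} unbounded Y cover disjoint =
  uncurry (diagonal-∉ disjoint) (cover diagonal diagonal-⊆)
  where
  open Enumeration unbounded
  open Diagonal em {C} enumerate-injective enumerate-∈ Y

filter⇒⊆* : ExcludedMiddle 0ℓ → (a b : Cantor) → RaisonnierFilter (𝒫 a) b → a ⊆* b
filter⇒⊆* em a b (Y , cover , H⊆b) = decidable-stable em λ ¬a⊆*b →
  unbounded-cover-meets-H em (¬finite⇒unbounded em ¬a⊆*b) Y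
    (λ x x⊆a∖b → cover x (λ m m∈x → proj₁ (x⊆a∖b m m∈x)))
    (λ n j j∈H j∈a∖b → proj₂ j∈a∖b (H⊆b n j j∈H))

lower-em : ExcludedMiddle (Level.suc 0ℓ) → ExcludedMiddle 0ℓ
lower-em em = map′ lower lift em

proposition3p3 : ExcludedMiddle (Level.suc 0ℓ) →
    (a : Cantor) → Infinite a →
      (b : Cantor) →
        (RaisonnierFilter (𝒫 a) b → a ⊆* b) × (a ⊆* b → RaisonnierFilter (𝒫 a) b)
proposition3p3 em a _ b = filter⇒⊆* (lower-em em) a b , ⊆*⇒filter a b
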